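{- Let $n$ be even. Let $S_1$ and $S_2$ be two disjoint sets of cells of an $n\times n$ array, each forming a $2$-factor that is the union of two cycles of length $n$. Then for any positive integers $s,t,u,v$ with $s>t+n$, $t>u+n$ and $u>v+n$, the cells of $S_1\cup S_2$ can be filled with integers to make a shiftable array whose support is $\{s+i,\,t+i,\,u+i,\,v+i\mid 1\leq i\leq n\}$ and in which the four entries in each row and in each column sum to $0$.
   Context: Identify the cells of an $n\times n$ array with the edges of $K_{n,n}$ with parts $\{a_1,\dots,a_n\}$, $\{b_1,\dots,b_n\}$ (cell $(i,j)$ corresponds to edge $\{a_i,b_j\}$). A set of cells forms a $2$-factor if the corresponding edges form a spanning $2$-regular subgraph of $K_{n,n}$; a cycle of length $n$ means a cycle in this graph with $n$ edges (i.e. on $n$ cells). The support of a partially filled array is the set of absolute values of its entries. A partially filled array is shiftable if each row and each column contains the same number of positive entries as negative entries. -}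

module Defs where

open import Data.Nat using (ℕ; zero; suc; _<_; _≤_; _<?_; s≤s; _+_)
open import Data.Fin using (Fin; zero; suc; toℕ; fromℕ<)
open import Data.Bool using (Bool; true; false; _∨_; if_then_else_)
open import Data.Integer using (ℤ; +_; -[1+_]; ∣_∣) renaming (_+_ to _+ℤ_)
open import Data.Maybe using (Maybe; just; nothing)
open import Data.Product using (Σ; _×_; ∃; ∃-syntax)
open import Data.Sum using (_⊎_)
open import Relation.Nullary using (¬_; yes; no)
open import Relation.Binary.PropositionalEquality using (_≡_)
open import Function.Definitions using (Injective)

-- A set of cells of an n×n array: cell (i,j) <-> edge {a_i , b_j} of K_{n,n}.
Cells : ℕ → Set
Cells n = Fin n → Fin n → Bool

count : ∀ {n} → (Fin n → Bool) → ℕ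
count {zero}  P = 0
count {suc n} P = (if P zero then 1 else 0) + count (λ k → P (suc k))

IsTwoFactor : ∀ {n} → Cells n → Set
IsTwoFactor {n} S = (∀ i → count (λ j → S i j) ≡ 2) × (∀ j → count (λ i → S i j) ≡ 2)

next : ∀ {k} → Fin (suc k) → Fin (suc k)
next {k} l with suc (toℕ l) <? suc k
... | yes p = fromℕ< p
... | no _  = zero

-- C is (the edge set of) a cycle with 2(k+1) edges in K_{n,n}, k+1 ≥ 2:
-- distinct rows r_0..r_k, distinct columns c_0..c_k, and
-- C = { (r_l , c_l) , (r_{l+1 mod (k+1)} , c_l) }  (cycle a_{r_0} b_{c_0} a_{r_1} b_{c_1} ...)
IsCycleOfLength : ∀ {n} → Cells n → ℕ → Set
IsCycleOfLength {n} C m =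
  Σ ℕ λ k → (1 ≤ k) × (m ≡ suc k + suc k) ×
  Σ (Fin (suc k) → Fin n) λ r → Σ (Fin (suc k) → Fin n) λ c →
    Injective _≡_ _≡_ r × Injective _≡_ _≡_ c ×
    (∀ i j → C i j ≡ true →
       ∃[ l ] ((i ≡ r l × j ≡ c l) ⊎ (i ≡ r (next l) × j ≡ c l))) ×
    (∀ l → C (r l) (c l) ≡ true) × (∀ l → C (r (next l)) (c l) ≡ true)

IsTwoFactorOfTwoNCycles : ∀ {n} → Cells n → Set
IsTwoFactorOfTwoNCycles {n} S =
  IsTwoFactor S ×
  Σ (Cells n) λ C₁ → Σ (Cells n) λ C₂ →
    IsCycleOfLength C₁ n × IsCycleOfLength C₂ n ×
    (∀ i j → ¬ (C₁ i j ≡ true × C₂ i j ≡ true)) ×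
    (∀ i j → S i j ≡ C₁ i j ∨ C₂ i j)

Disjoint : ∀ {n} → Cells n → Cells n → Set
Disjoint {n} S T = ∀ i j → ¬ (S i j ≡ true × T i j ≡ true)

-- partially filled array (nothing = empty cell)
PFA : ℕ → Set
PFA n = Fin n → Fin n → Maybe ℤ

isPos : Maybe ℤ → Bool
isPos (just (+ suc _)) = true
isPos _ = false

isNeg : Maybe ℤ → Bool
isNeg (just -[1+ _ ]) = true
isNeg _ = false

filled : Maybe ℤ → Bool
filled (just _) = true
filled nothing  = false

Shiftable : ∀ {n} → PFA n → Set
Shiftable {n} A =
  (∀ i → count (λ j → isPos (A i j)) ≡ count (λ j → isNeg (A i j))) ×
  (∀ j → count (λ i → isPos (A i j)) ≡ count (λ i → isNeg (A i j)))

sumLine : ∀ {n} → (Fin n → Maybe ℤ) → ℤ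
sumLine {zero}  f = + 0
sumLine {suc n} f = val (f zero) +ℤ sumLine (λ k → f (suc k))
  where
  val : Maybe ℤ → ℤ
  val (just x) = x
  val nothing  = + 0

HasSupport : ∀ {n} → PFA n → (ℕ → Set) → Set
HasSupport {n} A P =
  (∀ i j x → A i j ≡ just x → P ∣ x ∣) ×
  (∀ y → P y → ∃[ i ] ∃[ j ] ∃[ x ] (A i j ≡ just x × ∣ x ∣ ≡ y))

SuppSet : ℕ → ℕ → ℕ → ℕ → ℕ → ℕ → Set
SuppSet n s t u v y =
  ∃[ i ] ((1 ≤ i) × (i ≤ n) × (y ≡ s + i ⊎ y ≡ t + i ⊎ y ≡ u + i ⊎ y ≡ v + i))

-- Walk around an n-cycle from a chosen starting row and write X+1, -(X+2), X+3, ..., -(X+n) into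
-- its cells. Each column of the cycle then holds X+2l+1 and -(X+2l+2), summing to -1, and each row
-- holds X+2l+3 and -(X+2l+2), summing to +1, except the starting row, which sums to 1-n. Fill the two
-- cycles of S₁ this way with bases s and t, and the two cycles of S₂ with bases u and v and all signs
-- flipped. Every column sums to 0, and so does every row as soon as the starting rows chosen for S₁
-- are also those chosen for S₂. Such rows exist: if ρ lies on the first cycle of both factors, some
-- row of the second cycle of S₁ lies on the second cycle of S₂, for otherwise the first cycle of S₂
-- would pass through ρ and through all n/2 rows of the second cycle of S₁, n/2 + 1 rows in all.
-- Each cycle has one positive and one negative entry in each of its rows and columns, whence
-- shiftability.

module Submission where

open import Defs
open import Data.Nat using (ℕ; zero; suc; _<_; _≤_; s≤s; z≤n; _+_; ⌊_/2⌋)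
import Data.Nat.Properties as ℕ
open import Data.Nat.Divisibility using (_∣_)
open import Data.Fin using (Fin; zero; suc; toℕ; fromℕ; fromℕ<; inject₁; punchIn; _≟_)
import Data.Fin.Properties as Fin
open import Data.Bool using (Bool; true; false; _∨_; _∧_; if_then_else_)
open import Data.Bool.Properties using (∨-comm; ∨-identityʳ; ∨-zeroʳ; ∧-zeroʳ)
open import Data.Integer using (ℤ; +_; -[1+_]; +[1+_]; ∣_∣; -_; _⊖_) renaming (_+_ to _+ℤ_)
import Data.Integer.Properties as ℤ
open import Data.Maybe using (Maybe; just; nothing)
open import Data.Product using (Σ; _×_; _,_; ∃-syntax; Σ-syntax; proj₁; proj₂)
open import Data.Sum using (_⊎_; inj₁; inj₂)
open import Data.Empty using (⊥-elim)
open import Relation.Nullary using (¬_; Dec; yes; no; does; _⊎-dec_)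
open import Relation.Nullary.Decidable using (dec-true; dec-false)
open import Relation.Binary.PropositionalEquality
open import Function.Definitions using (Injective)
open import Function.Base using (_∘′_)
open import Data.Vec.Functional using (_∷_)
open import Relation.Unary using (_∪_)
open import Algebra.Properties.CommutativeMonoid.Sum ℤ.+-0-commutativeMonoid
  using (sum; sum-cong-≗; sum-replicate-zero; sum-remove; ∑-distrib-+)

-- Sums and counts over Fin

sum-zero : ∀ {m} (f : Fin m → ℤ) → (∀ x → f x ≡ + 0) → sum f ≡ + 0
sum-zero {m} f f≗0 = trans (sum-cong-≗ f≗0) (sum-replicate-zero m)

sum-concentrated : ∀ {m} (f : Fin m → ℤ) (x₀ : Fin m) → (∀ x → x ≢ x₀ → f x ≡ + 0) → sum f ≡ f x₀
sum-concentrated {suc m} f x₀ off = begin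
  sum f                                 ≡⟨ sum-remove f ⟩
  f x₀ +ℤ sum (λ x → f (punchIn x₀ x))  ≡⟨ cong (f x₀ +ℤ_) (sum-zero _ (λ x → off _ (Fin.punchInᵢ≢i x₀ x))) ⟩
  f x₀ +ℤ + 0                           ≡⟨ ℤ.+-identityʳ (f x₀) ⟩
  f x₀                                  ∎
  where open ≡-Reasoning

sum-neg : ∀ {m} (f : Fin m → ℤ) → sum (λ x → - f x) ≡ - sum f
sum-neg {zero}  f = refl
sum-neg {suc m} f = trans (cong (- f zero +ℤ_) (sum-neg (λ x → f (suc x)))) (sym (ℤ.neg-distrib-+ (f zero) _))

when : Bool → ℤ → ℤ
when b v = if b then v else + 0

when-comm : ∀ b b' v → when b (when b' v) ≡ when b' (when b v)
when-comm true  b' v = refl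
when-comm false true  v = refl
when-comm false false v = refl

when-+ : ∀ b v w → when b (v +ℤ w) ≡ when b v +ℤ when b w
when-+ true  v w = refl
when-+ false v w = refl

module _ {m n : ℕ} {F : Fin m → Fin n} {y : Fin n} where

  sum-when-injective : Injective _≡_ _≡_ F → (g : Fin m → ℤ) (x₀ : Fin m) → F x₀ ≡ y →
                       sum (λ x → when (does (F x ≟ y)) (g x)) ≡ g x₀
  sum-when-injective F-inj g x₀ Fx₀≡y = trans (sum-concentrated _ x₀ off)
    (cong (λ b → when b (g x₀)) (dec-true (F x₀ ≟ y) Fx₀≡y))
    where
    off : ∀ x → x ≢ x₀ → when (does (F x ≟ y)) (g x) ≡ + 0
    off x x≢x₀ = cong (λ b → when b (g x))
      (dec-false (F x ≟ y) (λ Fx≡y → x≢x₀ (F-inj (trans Fx≡y (sym Fx₀≡y)))))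

  sum-when-absent : (∀ x → F x ≢ y) → (g : Fin m → ℤ) → sum (λ x → when (does (F x ≟ y)) (g x)) ≡ + 0
  sum-when-absent y∉F g = sum-zero _ (λ x → cong (λ b → when b (g x)) (dec-false (F x ≟ y) (y∉F x)))

does-≟-sym : ∀ {n} (x y : Fin n) → does (x ≟ y) ≡ does (y ≟ x)
does-≟-sym x y with x ≟ y | y ≟ x
... | yes _   | yes _   = refl
... | no _    | no _    = refl
... | yes x≡y | no y≢x  = ⊥-elim (y≢x (sym x≡y))
... | no x≢y  | yes y≡x = ⊥-elim (x≢y (sym y≡x))

single : ∀ {n} → Fin n → ℤ → Fin n → ℤ
single y v x = when (does (x ≟ y)) v

single-at : ∀ {n} (y : Fin n) v → single y v y ≡ v
single-at y v = cong (λ b → when b v) (dec-true (y ≟ y) refl)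

single-off : ∀ {n} {y x : Fin n} v → x ≢ y → single y v x ≡ + 0
single-off {y = y} {x} v x≢y = cong (λ b → when b v) (dec-false (x ≟ y) x≢y)

sum-single : ∀ {n} (y : Fin n) v → sum (single y v) ≡ v
sum-single y v = sum-when-injective (λ eq → eq) (λ _ → v) y refl

count-cong : ∀ {m} {P Q : Fin m → Bool} → (∀ x → P x ≡ Q x) → count P ≡ count Q
count-cong {zero}  P≗Q = refl
count-cong {suc m} P≗Q =
  cong₂ (λ b c → (if b then 1 else 0) + c) (P≗Q zero) (count-cong (λ x → P≗Q (suc x)))

count-false : ∀ {m} {P : Fin m → Bool} → (∀ x → P x ≡ false) → count P ≡ 0
count-false {zero}  P≗false = refl
count-false {suc m} P≗false rewrite P≗false zero = count-false (λ x → P≗false (suc x))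

count-∨ : ∀ {m} (P Q : Fin m → Bool) → (∀ x → P x ∧ Q x ≡ false) →
          count (λ x → P x ∨ Q x) ≡ count P + count Q
count-∨ {zero}  P Q disj = refl
count-∨ {suc m} P Q disj
  with P zero | Q zero | disj zero | count-∨ (λ x → P (suc x)) (λ x → Q (suc x)) (λ x → disj (suc x))
... | true  | false | _ | ih = cong suc ih
... | false | true  | _ | ih = trans (cong suc ih) (sym (ℕ.+-suc _ _))
... | false | false | _ | ih = ih

count-≟ : ∀ {m} (y : Fin m) → count (λ x → does (x ≟ y)) ≡ 1
count-≟ {suc m} zero    = cong suc (count-false {m} (λ x → refl))
count-≟ {suc m} (suc y) = count-≟ y

≡-does : ∀ {P : Set} {b : Bool} (P? : Dec P) → (b ≡ true → P) → (P → b ≡ true) → b ≡ does P?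
≡-does         (yes p) _  from = from p
≡-does {b = false} (no ¬p) _  _ = refl
≡-does {b = true}  (no ¬p) to _ = ⊥-elim (¬p (to refl))

≟-exclusive : ∀ {n} {y y' : Fin n} → y ≢ y' → ∀ x → does (x ≟ y) ∧ does (x ≟ y') ≡ false
≟-exclusive {y = y} {y'} y≢y' x with x ≟ y | x ≟ y'
... | yes x≡y  | yes x≡y' = ⊥-elim (y≢y' (trans (sym x≡y) x≡y'))
... | yes _    | no _     = refl
... | no _     | _        = refl

count-pair : ∀ {n} {y y' : Fin n} → y ≢ y' → count (λ x → does ((x ≟ y) ⊎-dec (x ≟ y'))) ≡ 2
count-pair {y = y} {y'} y≢y' =
  trans (count-∨ (λ x → does (x ≟ y)) (λ x → does (x ≟ y')) (≟-exclusive y≢y'))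
        (cong₂ _+_ (count-≟ y) (count-≟ y'))

Balanced : ∀ {m} → (Fin m → ℤ) → Set
Balanced f = count (λ x → isPos (just (f x))) ≡ count (λ x → isNeg (just (f x)))

balanced-cong : ∀ {m} {f g : Fin m → ℤ} → (∀ x → f x ≡ g x) → Balanced g → Balanced f
balanced-cong f≗g bal =
  trans (count-cong (λ x → cong (isPos ∘′ just) (f≗g x)))
        (trans bal (count-cong (λ x → cong (isNeg ∘′ just) (sym (f≗g x)))))

count-sign-+ : ∀ {m} (P : Maybe ℤ → Bool) → P (just (+ 0)) ≡ false → (f g : Fin m → ℤ) →
               (∀ x → f x ≡ + 0 ⊎ g x ≡ + 0) →
               count (λ x → P (just (f x +ℤ g x))) ≡ count (λ x → P (just (f x))) + count (λ x → P (just (g x)))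
count-sign-+ P P0≡false f g disj = trans (count-cong split) (count-∨ _ _ exclusive)
  where
  split : ∀ x → P (just (f x +ℤ g x)) ≡ P (just (f x)) ∨ P (just (g x))
  split x with disj x
  ... | inj₁ fx≡0 rewrite fx≡0 | P0≡false = cong (P ∘′ just) (ℤ.+-identityˡ (g x))
  ... | inj₂ gx≡0 rewrite gx≡0 | P0≡false =
    trans (cong (P ∘′ just) (ℤ.+-identityʳ (f x))) (sym (∨-identityʳ _))
  exclusive : ∀ x → P (just (f x)) ∧ P (just (g x)) ≡ false
  exclusive x with disj x
  ... | inj₁ fx≡0 rewrite fx≡0 | P0≡false = refl
  ... | inj₂ gx≡0 rewrite gx≡0 | P0≡false = ∧-zeroʳ _

balanced-+ : ∀ {m} {f g : Fin m → ℤ} → (∀ x → f x ≡ + 0 ⊎ g x ≡ + 0) →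
             Balanced f → Balanced g → Balanced (λ x → f x +ℤ g x)
balanced-+ {f = f} {g} disj bal-f bal-g =
  trans (count-sign-+ isPos refl f g disj) (trans (cong₂ _+_ bal-f bal-g) (sym (count-sign-+ isNeg refl f g disj)))

balanced-neg : ∀ {m} {f : Fin m → ℤ} → Balanced f → Balanced (λ x → - f x)
balanced-neg {f = f} bal =
  trans (count-cong (λ x → isPos-neg (f x))) (trans (sym bal) (count-cong (λ x → sym (isNeg-neg (f x)))))
  where
  isPos-neg : ∀ z → isPos (just (- z)) ≡ isNeg (just z)
  isPos-neg (+ zero)  = refl
  isPos-neg +[1+ _ ]  = refl
  isPos-neg -[1+ _ ]  = refl
  isNeg-neg : ∀ z → isNeg (just (- z)) ≡ isPos (just z)
  isNeg-neg (+ zero)  = refl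
  isNeg-neg +[1+ _ ]  = refl
  isNeg-neg -[1+ _ ]  = refl

balanced-pair : ∀ {m} {y y' : Fin m} → y ≢ y' → ∀ p q →
                Balanced (λ x → single y +[1+ p ] x +ℤ single y' -[1+ q ] x)
balanced-pair {y = y} {y'} y≢y' p q =
  trans (count-cong positive) (trans (trans (count-≟ y) (sym (count-≟ y'))) (count-cong (λ x → sym (negative x))))
  where
  positive : ∀ x → isPos (just (single y +[1+ p ] x +ℤ single y' -[1+ q ] x)) ≡ does (x ≟ y)
  positive x with x ≟ y | x ≟ y'
  ... | yes refl | yes refl = ⊥-elim (y≢y' refl)
  ... | yes _    | no _     = refl
  ... | no _     | yes _    = refl
  ... | no _     | no _     = refl
  negative : ∀ x → isNeg (just (single y +[1+ p ] x +ℤ single y' -[1+ q ] x)) ≡ does (x ≟ y')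
  negative x with x ≟ y | x ≟ y'
  ... | yes refl | yes refl = ⊥-elim (y≢y' refl)
  ... | yes _    | no _     = refl
  ... | no _     | yes _    = refl
  ... | no _     | no _     = refl

-- Fillings of cell sets

∨-≡-false : ∀ {a b : Bool} → a ∨ b ≡ false → a ≡ false × b ≡ false
∨-≡-false {false} {false} _ = refl , refl

∨-≡-true : ∀ {a b : Bool} → a ∨ b ≡ true → a ≡ true ⊎ b ≡ true
∨-≡-true {true}  _ = inj₁ refl
∨-≡-true {false} e = inj₂ e

disjoint⇒false : ∀ {n} {S T : Cells n} → Disjoint S T → ∀ {i j} → S i j ≡ true → T i j ≡ false
disjoint⇒false {T = T} S∩T=∅ {i} {j} Sij with T i j in Tij
... | false = refl
... | true  = ⊥-elim (S∩T=∅ i j (Sij , Tij))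

disjoint-∧ : ∀ {n} {S T : Cells n} → Disjoint S T → ∀ i j → S i j ∧ T i j ≡ false
disjoint-∧ {S = S} S∩T=∅ i j with S i j in Sij
... | false = refl
... | true  = disjoint⇒false S∩T=∅ Sij

-- Integer arrays stand for partially filled arrays whose empty cells are those outside S (see toPFA),
-- with support P.
record Filling {n} (S : Cells n) (P : ℕ → Set) (E : Fin n → Fin n → ℤ) : Set where
  field
    vanishes      : ∀ {i j} → S i j ≡ false → E i j ≡ + 0
    entries       : ∀ {i j} → S i j ≡ true → P ∣ E i j ∣
    attains       : ∀ {y} → P y → ∃[ i ] ∃[ j ] (S i j ≡ true × ∣ E i j ∣ ≡ y)
    rows-balanced : ∀ i → Balanced (λ j → E i j)
    cols-balanced : ∀ j → Balanced (λ i → E i j)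

module _ {n} {S T U : Cells n} {P Q : ℕ → Set} {E E' : Fin n → Fin n → ℤ} where

  filling-∪ : (∀ i j → U i j ≡ S i j ∨ T i j) → Disjoint S T → Filling S P E → Filling T Q E' →
              Filling U (P ∪ Q) (λ i j → E i j +ℤ E' i j)
  filling-∪ U≡S∪T S∩T=∅ F F' = record
    { vanishes      = vanishes
    ; entries       = entries
    ; attains       = attains
    ; rows-balanced = λ i → balanced-+ (λ j → separated i j)
                              (Filling.rows-balanced F i) (Filling.rows-balanced F' i)
    ; cols-balanced = λ j → balanced-+ (λ i → separated i j)
                              (Filling.cols-balanced F j) (Filling.cols-balanced F' j)
    }
    where
    on-S : ∀ {i j} → S i j ≡ true → E i j +ℤ E' i j ≡ E i j
    on-S {i} {j} Sij = trans (cong (E i j +ℤ_) (Filling.vanishes F' (disjoint⇒false S∩T=∅ Sij))) (ℤ.+-identityʳ _)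
    on-T : ∀ {i j} → T i j ≡ true → E i j +ℤ E' i j ≡ E' i j
    on-T {i} {j} Tij = trans (cong (_+ℤ E' i j) (Filling.vanishes F (disjoint⇒false T∩S=∅ Tij))) (ℤ.+-identityˡ _)
      where
      T∩S=∅ : Disjoint T S
      T∩S=∅ i j (t , s) = S∩T=∅ i j (s , t)
    separated : ∀ i j → E i j ≡ + 0 ⊎ E' i j ≡ + 0
    separated i j with S i j in Sij
    ... | false = inj₁ (Filling.vanishes F Sij)
    ... | true  = inj₂ (Filling.vanishes F' (disjoint⇒false S∩T=∅ Sij))
    vanishes : ∀ {i j} → U i j ≡ false → E i j +ℤ E' i j ≡ + 0
    vanishes {i} {j} Uij with ∨-≡-false (trans (sym (U≡S∪T i j)) Uij)
    ... | Sij , Tij = cong₂ _+ℤ_ (Filling.vanishes F Sij) (Filling.vanishes F' Tij)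
    entries : ∀ {i j} → U i j ≡ true → (P ∪ Q) ∣ E i j +ℤ E' i j ∣
    entries {i} {j} Uij with ∨-≡-true (trans (sym (U≡S∪T i j)) Uij)
    ... | inj₁ Sij = inj₁ (subst (P ∘′ ∣_∣) (sym (on-S Sij)) (Filling.entries F Sij))
    ... | inj₂ Tij = inj₂ (subst (Q ∘′ ∣_∣) (sym (on-T Tij)) (Filling.entries F' Tij))
    attains : ∀ {y} → (P ∪ Q) y → ∃[ i ] ∃[ j ] (U i j ≡ true × ∣ E i j +ℤ E' i j ∣ ≡ y)
    attains (inj₁ y∈P) with Filling.attains F y∈P
    ... | i , j , Sij , ∣Eij∣≡y =
      i , j , trans (U≡S∪T i j) (cong (_∨ T i j) Sij) , trans (cong ∣_∣ (on-S Sij)) ∣Eij∣≡y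
    attains (inj₂ y∈Q) with Filling.attains F' y∈Q
    ... | i , j , Tij , ∣E'ij∣≡y =
      i , j , trans (U≡S∪T i j) (trans (cong (S i j ∨_) Tij) (∨-zeroʳ _))
            , trans (cong ∣_∣ (on-T Tij)) ∣E'ij∣≡y

module _ {n} {S : Cells n} {P : ℕ → Set} {E : Fin n → Fin n → ℤ} where

  filling-neg : Filling S P E → Filling S P (λ i j → - E i j)
  filling-neg F = record
    { vanishes      = λ Sij → cong -_ (Filling.vanishes F Sij)
    ; entries       = λ {i} {j} Sij → subst P (sym (ℤ.∣-i∣≡∣i∣ (E i j))) (Filling.entries F Sij)
    ; attains       = λ y∈P → let i , j , Sij , ∣Eij∣≡y = Filling.attains F y∈P in
                              i , j , Sij , trans (ℤ.∣-i∣≡∣i∣ (E i j)) ∣Eij∣≡y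
    ; rows-balanced = λ i → balanced-neg {f = E i} (Filling.rows-balanced F i)
    ; cols-balanced = λ j → balanced-neg {f = λ i → E i j} (Filling.cols-balanced F j)
    }

  filling-⇔ : ∀ {Q : ℕ → Set} → (∀ {y} → P y → Q y) → (∀ {y} → Q y → P y) →
              Filling S P E → Filling S Q E
  filling-⇔ P⊆Q Q⊆P F = record
    { vanishes      = Filling.vanishes F
    ; entries       = λ Sij → P⊆Q (Filling.entries F Sij)
    ; attains       = λ y∈Q → Filling.attains F (Q⊆P y∈Q)
    ; rows-balanced = Filling.rows-balanced F
    ; cols-balanced = Filling.cols-balanced F
    }

toPFA : ∀ {n} → Cells n → (Fin n → Fin n → ℤ) → PFA n
toPFA S E i j = if S i j then just (E i j) else nothing

sumLine-masked : ∀ {m} (b : Fin m → Bool) (g : Fin m → ℤ) → (∀ x → b x ≡ false → g x ≡ + 0) →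
                 sumLine (λ x → if b x then just (g x) else nothing) ≡ sum g
sumLine-masked {zero}  b g vanish = refl
sumLine-masked {suc m} b g vanish with b zero in b₀
... | true  = cong (g zero +ℤ_) (sumLine-masked (b ∘′ suc) (g ∘′ suc) (λ x → vanish (suc x)))
... | false = cong₂ _+ℤ_ (sym (vanish zero b₀)) (sumLine-masked (b ∘′ suc) (g ∘′ suc) (λ x → vanish (suc x)))

module _ {n} {S : Cells n} {P : ℕ → Set} {E : Fin n → Fin n → ℤ} (F : Filling S P E) where
  open Filling F

  toPFA-filled : ∀ i j → filled (toPFA S E i j) ≡ S i j
  toPFA-filled i j with S i j
  ... | true  = refl
  ... | false = refl

  toPFA-sign : (σ : Maybe ℤ → Bool) → σ nothing ≡ σ (just (+ 0)) →
               ∀ i j → σ (toPFA S E i j) ≡ σ (just (E i j))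
  toPFA-sign σ σ0 i j with S i j in Sij
  ... | true  = refl
  ... | false = trans σ0 (cong (σ ∘′ just) (sym (vanishes Sij)))

  toPFA-shiftable : Shiftable (toPFA S E)
  toPFA-shiftable =
      (λ i → trans (count-cong (toPFA-sign isPos refl i))
                   (trans (rows-balanced i) (count-cong (λ j → sym (toPFA-sign isNeg refl i j)))))
    , (λ j → trans (count-cong (λ i → toPFA-sign isPos refl i j))
                   (trans (cols-balanced j) (count-cong (λ i → sym (toPFA-sign isNeg refl i j)))))

  toPFA-support : HasSupport (toPFA S E) P
  toPFA-support = entry-in-P , attained
    where
    entry-in-P : ∀ i j x → toPFA S E i j ≡ just x → P ∣ x ∣
    entry-in-P i j x eq with S i j in Sij | eq
    ... | true | refl = entries Sij
    attained : ∀ y → P y → ∃[ i ] ∃[ j ] ∃[ x ] (toPFA S E i j ≡ just x × ∣ x ∣ ≡ y)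
    attained y y∈P with attains y∈P
    ... | i , j , Sij , ∣Eij∣≡y = i , j , E i j , cong (λ b → if b then just (E i j) else nothing) Sij , ∣Eij∣≡y

  toPFA-row-sum : ∀ i → sumLine (λ j → toPFA S E i j) ≡ sum (λ j → E i j)
  toPFA-row-sum i = sumLine-masked (S i) (E i) (λ j → vanishes)

  toPFA-col-sum : ∀ j → sumLine (λ i → toPFA S E i j) ≡ sum (λ i → E i j)
  toPFA-col-sum j = sumLine-masked (λ i → S i j) (λ i → E i j) (λ i → vanishes)

-- Cycles

module _ {k : ℕ} where

  next-toℕ : (l : Fin (suc k)) → toℕ (next l) ≡ suc (toℕ l) ⊎ (next l ≡ zero × toℕ l ≡ k)
  next-toℕ l with suc (toℕ l) ℕ.<? suc k
  ... | yes l+1<k+1 = inj₁ (Fin.toℕ-fromℕ< l+1<k+1)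
  ... | no  l+1≮k+1 = inj₂ (refl , ℕ.≤-antisym (Fin.toℕ≤pred[n] l) (ℕ.≤-pred (ℕ.≮⇒≥ l+1≮k+1)))

  next-injective : Injective _≡_ _≡_ (next {k})
  next-injective {a} {b} eq with next-toℕ a | next-toℕ b
  ... | inj₁ a↦a+1 | inj₁ b↦b+1 =
    Fin.toℕ-injective (ℕ.suc-injective (trans (sym a↦a+1) (trans (cong toℕ eq) b↦b+1)))
  ... | inj₁ a↦a+1 | inj₂ (b↦0 , _) = ⊥-elim (ℕ.0≢1+n (trans (sym (cong toℕ (trans eq b↦0))) a↦a+1))
  ... | inj₂ (a↦0 , _) | inj₁ b↦b+1 = ⊥-elim (ℕ.0≢1+n (trans (sym (cong toℕ (trans (sym eq) a↦0))) b↦b+1))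
  ... | inj₂ (_ , a≡k) | inj₂ (_ , b≡k) = Fin.toℕ-injective (trans a≡k (sym b≡k))

  next-surjective : (l : Fin (suc k)) → ∃[ l' ] next l' ≡ l
  next-surjective zero with next-toℕ (fromℕ k)
  ... | inj₁ last↦k+1 =
    ⊥-elim (ℕ.<-irrefl (trans last↦k+1 (cong suc (Fin.toℕ-fromℕ k))) (Fin.toℕ<n (next (fromℕ k))))
  ... | inj₂ (last↦0 , _) = fromℕ k , last↦0
  next-surjective (suc m) with next-toℕ (inject₁ m)
  ... | inj₁ m↦m+1 = inject₁ m , Fin.toℕ-injective (trans m↦m+1 (cong suc (Fin.toℕ-inject₁ m)))
  ... | inj₂ (_ , m≡k) = ⊥-elim (ℕ.<-irrefl (trans (sym (Fin.toℕ-inject₁ m)) m≡k) (Fin.toℕ<n m))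

  next-≢ : 1 ≤ k → (l : Fin (suc k)) → next l ≢ l
  next-≢ 1≤k l eq with next-toℕ l
  ... | inj₁ l↦l+1 = ℕ.1+n≢n (trans (sym l↦l+1) (cong toℕ eq))
  ... | inj₂ (l↦0 , l≡k) = ℕ.<⇒≢ 1≤k (sym (trans (sym l≡k) (cong toℕ (trans (sym eq) l↦0))))

  advance : ℕ → Fin (suc k) → Fin (suc k)
  advance zero    l = l
  advance (suc j) l = next (advance j l)

  advance-next : ∀ j l → advance j (next l) ≡ next (advance j l)
  advance-next zero    l = refl
  advance-next (suc j) l = cong next (advance-next j l)

  advance-injective : ∀ j → Injective _≡_ _≡_ (advance j)
  advance-injective zero    eq = eq
  advance-injective (suc j) eq = advance-injective j (next-injective eq)

  advance-surjective : ∀ j l → ∃[ l' ] advance j l' ≡ l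
  advance-surjective zero    l = l , refl
  advance-surjective (suc j) l with next-surjective l
  ... | l₁ , l₁↦l with advance-surjective j l₁
  ... | l' , l'↦l₁ = l' , trans (cong next l'↦l₁) l₁↦l

  toℕ-advance-zero : ∀ j → j ≤ k → toℕ (advance j zero) ≡ j
  toℕ-advance-zero zero    _   = refl
  toℕ-advance-zero (suc j) j<k with next-toℕ (advance j zero) | toℕ-advance-zero j (ℕ.<⇒≤ j<k)
  ... | inj₁ step       | ih = trans step (cong suc ih)
  ... | inj₂ (_ , at-k) | ih = ⊥-elim (ℕ.<-irrefl (trans (sym ih) at-k) j<k)

  advance-to : ∀ l → advance (toℕ l) zero ≡ l
  advance-to l = Fin.toℕ-injective (toℕ-advance-zero (toℕ l) (Fin.toℕ≤pred[n] l))

record Cycle {n} (k : ℕ) (C : Cells n) : Set where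
  field
    nontrivial  : 1 ≤ k
    r c         : Fin (suc k) → Fin n
    r-injective : Injective _≡_ _≡_ r
    c-injective : Injective _≡_ _≡_ c
    within      : ∀ i j → C i j ≡ true → ∃[ l ] ((i ≡ r l × j ≡ c l) ⊎ (i ≡ r (next l) × j ≡ c l))
    forward     : ∀ l → C (r l) (c l) ≡ true
    backward    : ∀ l → C (r (next l)) (c l) ≡ true

toCycle : ∀ {n k : ℕ} {C : Cells n} → n ≡ suc k + suc k → IsCycleOfLength C n → Cycle k C
toCycle {k = k} {C} n≡ (k' , 1≤k' , n≡' , r , c , r-inj , c-inj , within , fwd , bwd) =
  subst (λ k → Cycle k C) k'≡k record
    { nontrivial = 1≤k' ; r = r ; c = c ; r-injective = r-inj ; c-injective = c-inj
    ; within = within ; forward = fwd ; backward = bwd }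
  where
  k'≡k : k' ≡ k
  k'≡k = ℕ.suc-injective (trans (ℕ.n≡⌊n+n/2⌋ (suc k'))
           (trans (cong ⌊_/2⌋ (trans (sym n≡') n≡)) (sym (ℕ.n≡⌊n+n/2⌋ (suc k)))))

module _ {n k : ℕ} {C : Cells n} (D : Cycle k C) where
  open Cycle D

  InRows InCols : Fin n → Set
  InRows i = ∃[ l ] r l ≡ i
  InCols j = ∃[ l ] c l ≡ j

  inRows? : ∀ i → Dec (InRows i)
  inRows? i = Fin.any? (λ l → r l ≟ i)

  inCols? : ∀ j → Dec (InCols j)
  inCols? j = Fin.any? (λ l → c l ≟ j)

  entering : ∀ {i} → InRows i → ∃[ l ] r (next l) ≡ i
  entering (l₀ , rl₀≡i) with next-surjective l₀
  ... | l , l↦l₀ = l , trans (cong r l↦l₀) rl₀≡i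

  r-next-≢ : ∀ l → r (next l) ≢ r l
  r-next-≢ l eq = next-≢ nontrivial l (r-injective eq)

  c-next-≢ : ∀ l → c (next l) ≢ c l
  c-next-≢ l eq = next-≢ nontrivial l (c-injective eq)

  row-cells : ∀ {i} l → r (next l) ≡ i → ∀ j → C i j ≡ does ((j ≟ c (next l)) ⊎-dec (j ≟ c l))
  row-cells {i} l r-next-l≡i j = ≡-does ((j ≟ c (next l)) ⊎-dec (j ≟ c l)) to from
    where
    to : C i j ≡ true → j ≡ c (next l) ⊎ j ≡ c l
    to Cij with within i j Cij
    ... | l' , inj₁ (i≡ , j≡) = inj₁ (trans j≡ (cong c (r-injective (trans (sym i≡) (sym r-next-l≡i)))))
    ... | l' , inj₂ (i≡ , j≡) =
      inj₂ (trans j≡ (cong c (next-injective (r-injective (trans (sym i≡) (sym r-next-l≡i))))))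
    from : j ≡ c (next l) ⊎ j ≡ c l → C i j ≡ true
    from (inj₁ refl) = subst (λ i → C i (c (next l)) ≡ true) r-next-l≡i (forward (next l))
    from (inj₂ refl) = subst (λ i → C i (c l) ≡ true) r-next-l≡i (backward l)

  col-cells : ∀ {j} l → c l ≡ j → ∀ i → C i j ≡ does ((i ≟ r l) ⊎-dec (i ≟ r (next l)))
  col-cells {j} l cl≡j i = ≡-does ((i ≟ r l) ⊎-dec (i ≟ r (next l))) to from
    where
    to : C i j ≡ true → i ≡ r l ⊎ i ≡ r (next l)
    to Cij with within i j Cij
    ... | l' , inj₁ (i≡ , j≡) = inj₁ (trans i≡ (cong r (c-injective (trans (sym j≡) (sym cl≡j)))))
    ... | l' , inj₂ (i≡ , j≡) = inj₂ (trans i≡ (cong (r ∘′ next) (c-injective (trans (sym j≡) (sym cl≡j)))))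
    from : i ≡ r l ⊎ i ≡ r (next l) → C i j ≡ true
    from (inj₁ refl) = subst (λ j → C (r l) j ≡ true) cl≡j (forward l)
    from (inj₂ refl) = subst (λ j → C (r (next l)) j ≡ true) cl≡j (backward l)

  row-cells-off : ∀ {i} → ¬ InRows i → ∀ j → C i j ≡ false
  row-cells-off {i} i∉ j with C i j in Cij
  ... | false = refl
  ... | true with within i j Cij
  ...   | l , inj₁ (i≡ , _) = ⊥-elim (i∉ (l , sym i≡))
  ...   | l , inj₂ (i≡ , _) = ⊥-elim (i∉ (next l , sym i≡))

  col-cells-off : ∀ {j} → ¬ InCols j → ∀ i → C i j ≡ false
  col-cells-off {j} j∉ i with C i j in Cij
  ... | false = refl
  ... | true with within i j Cij
  ...   | l , inj₁ (_ , j≡) = ⊥-elim (j∉ (l , sym j≡))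
  ...   | l , inj₂ (_ , j≡) = ⊥-elim (j∉ (l , sym j≡))

  row-count-on : ∀ {i} → InRows i → count (λ j → C i j) ≡ 2
  row-count-on i∈ with entering i∈
  ... | l , r-next-l≡i = trans (count-cong (row-cells l r-next-l≡i)) (count-pair (c-next-≢ l))

  row-count-off : ∀ {i} → ¬ InRows i → count (λ j → C i j) ≡ 0
  row-count-off i∉ = count-false (row-cells-off i∉)

  col-count-on : ∀ {j} → InCols j → count (λ i → C i j) ≡ 2
  col-count-on (l , cl≡j) = trans (count-cong (col-cells l cl≡j)) (count-pair (λ eq → r-next-≢ l (sym eq)))

  col-count-off : ∀ {j} → ¬ InCols j → count (λ i → C i j) ≡ 0
  col-count-off j∉ = count-false (col-cells-off j∉)

  rotate : Fin (suc k) → Cycle k C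
  rotate m = record
    { nontrivial  = nontrivial
    ; r           = r ∘′ σ
    ; c           = c ∘′ σ
    ; r-injective = λ eq → advance-injective (toℕ m) (r-injective eq)
    ; c-injective = λ eq → advance-injective (toℕ m) (c-injective eq)
    ; within      = within′
    ; forward     = λ l → forward (σ l)
    ; backward    = λ l → subst (λ x → C (r x) (c (σ l)) ≡ true)
                                 (sym (advance-next (toℕ m) l)) (backward (σ l))
    }
    where
    σ : Fin (suc k) → Fin (suc k)
    σ = advance (toℕ m)
    within′ : ∀ i j → C i j ≡ true →
              ∃[ l ] ((i ≡ r (σ l) × j ≡ c (σ l)) ⊎ (i ≡ r (σ (next l)) × j ≡ c (σ l)))
    within′ i j Cij with within i j Cij
    ... | l , cell with advance-surjective (toℕ m) l
    ...   | l' , refl with cell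
    ...     | inj₁ on-forward = l' , inj₁ on-forward
    ...     | inj₂ (i≡ , j≡)  = l' , inj₂ (trans i≡ (cong r (sym (advance-next (toℕ m) l'))) , j≡)

  rotate-start : ∀ m → Cycle.r (rotate m) zero ≡ r m
  rotate-start m = cong r (advance-to m)

  -- a l in cell (r l , c l), b l in cell (r (next l) , c l), and 0 elsewhere.
  fill : (a b : Fin (suc k) → ℤ) → Fin n → Fin n → ℤ
  fill a b i j = sum (λ l → when (does (r l ≟ i)) (single (c l) (a l) j))
               +ℤ sum (λ l → when (does (r (next l) ≟ i)) (single (c l) (b l) j))

  module _ (a b : Fin (suc k) → ℤ) where

    fill-row : ∀ {i} l → r (next l) ≡ i →
               ∀ j → fill a b i j ≡ single (c (next l)) (a (next l)) j +ℤ single (c l) (b l) j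
    fill-row l r-next-l≡i j = cong₂ _+ℤ_
      (sum-when-injective r-injective (λ l → single (c l) (a l) j) (next l) r-next-l≡i)
      (sum-when-injective (λ eq → next-injective (r-injective eq)) (λ l → single (c l) (b l) j) l r-next-l≡i)

    fill-row-off : ∀ {i} → ¬ InRows i → ∀ j → fill a b i j ≡ + 0
    fill-row-off i∉ j = cong₂ _+ℤ_
      (sum-when-absent (λ l eq → i∉ (l , eq)) (λ l → single (c l) (a l) j))
      (sum-when-absent (λ l eq → i∉ (next l , eq)) (λ l → single (c l) (b l) j))

    fill-col : ∀ {j} l → c l ≡ j →
               ∀ i → fill a b i j ≡ single (r l) (a l) i +ℤ single (r (next l)) (b l) i
    fill-col {j} l cl≡j i = trans (sym (∑-distrib-+ (λ l → when (does (r l ≟ i)) (single (c l) (a l) j))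
                                                   (λ l → when (does (r (next l) ≟ i)) (single (c l) (b l) j))))
      (trans (sum-cong-≗ by-column)
      (sum-when-injective c-injective (λ l → single (r l) (a l) i +ℤ single (r (next l)) (b l) i) l cl≡j))
      where
      by-column : ∀ l → when (does (r l ≟ i)) (single (c l) (a l) j)
                        +ℤ when (does (r (next l) ≟ i)) (single (c l) (b l) j)
                      ≡ when (does (c l ≟ j)) (single (r l) (a l) i +ℤ single (r (next l)) (b l) i)
      by-column l rewrite does-≟-sym j (c l) | does-≟-sym i (r l) | does-≟-sym i (r (next l))
        | when-comm (does (r l ≟ i)) (does (c l ≟ j)) (a l)
        | when-comm (does (r (next l) ≟ i)) (does (c l ≟ j)) (b l)
        = sym (when-+ (does (c l ≟ j)) _ _)

    fill-forward : ∀ l → fill a b (r l) (c l) ≡ a l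
    fill-forward l = trans (fill-col l refl (r l))
      (trans (cong₂ _+ℤ_ (single-at (r l) (a l)) (single-off (b l) (λ eq → r-next-≢ l (sym eq))))
             (ℤ.+-identityʳ (a l)))

    fill-backward : ∀ l → fill a b (r (next l)) (c l) ≡ b l
    fill-backward l = trans (fill-col l refl (r (next l)))
      (trans (cong (_+ℤ single (r (next l)) (b l) (r (next l))) (single-off (a l) (r-next-≢ l)))
             (trans (ℤ.+-identityˡ _) (single-at (r (next l)) (b l))))

    fill-vanishes : ∀ {i j} → C i j ≡ false → fill a b i j ≡ + 0
    fill-vanishes {i} {j} Cij≡false with inRows? i
    ... | no i∉ = fill-row-off i∉ j
    ... | yes i∈ with entering i∈
    ...   | l , r-next-l≡i = trans (fill-row l r-next-l≡i j)
      (cong₂ _+ℤ_ (single-off _ (λ eq → off (inj₁ eq))) (single-off _ (λ eq → off (inj₂ eq))))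
      where
      off : ¬ (j ≡ c (next l) ⊎ j ≡ c l)
      off on = ⊥-elim (ℕ.0≢1+n (cong (λ b → if b then 1 else 0)
        (trans (sym Cij≡false) (trans (row-cells l r-next-l≡i j) (dec-true ((j ≟ c (next l)) ⊎-dec (j ≟ c l)) on)))))

    fill-row-sum : ∀ {i} l → r (next l) ≡ i → sum (λ j → fill a b i j) ≡ a (next l) +ℤ b l
    fill-row-sum l r-next-l≡i = trans (sum-cong-≗ (fill-row l r-next-l≡i))
      (trans (∑-distrib-+ (single (c (next l)) (a (next l))) (single (c l) (b l)))
             (cong₂ _+ℤ_ (sum-single (c (next l)) (a (next l))) (sum-single (c l) (b l))))

    fill-row-sum-off : ∀ {i} → ¬ InRows i → sum (λ j → fill a b i j) ≡ + 0
    fill-row-sum-off i∉ = sum-zero _ (fill-row-off i∉)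

    fill-col-sum : ∀ {j} l → c l ≡ j → sum (λ i → fill a b i j) ≡ a l +ℤ b l
    fill-col-sum l cl≡j = trans (sum-cong-≗ (fill-col l cl≡j))
      (trans (∑-distrib-+ (single (r l) (a l)) (single (r (next l)) (b l)))
             (cong₂ _+ℤ_ (sum-single (r l) (a l)) (sum-single (r (next l)) (b l))))

    fill-col-sum-off : ∀ {j} → ¬ InCols j → sum (λ i → fill a b i j) ≡ + 0
    fill-col-sum-off j∉ = sum-zero _ (λ i → fill-vanishes (col-cells-off j∉ i))

  module _ (α β : Fin (suc k) → ℕ) where

    private
      a b : Fin (suc k) → ℤ
      a l = +[1+ α l ]
      b l = -[1+ β l ]

    fill-rows-balanced : ∀ i → Balanced (λ j → fill a b i j)
    fill-rows-balanced i with inRows? i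
    ... | no i∉ = balanced-cong (fill-row-off a b i∉) refl
    ... | yes i∈ with entering i∈
    ...   | l , r-next-l≡i =
      balanced-cong (fill-row a b l r-next-l≡i) (balanced-pair (c-next-≢ l) (α (next l)) (β l))

    fill-cols-balanced : ∀ j → Balanced (λ i → fill a b i j)
    fill-cols-balanced j with inCols? j
    ... | no j∉ = balanced-cong (λ i → fill-vanishes a b (col-cells-off j∉ i)) refl
    ... | yes (l , cl≡j) =
      balanced-cong (fill-col a b l cl≡j) (balanced-pair (λ eq → r-next-≢ l (sym eq)) (α l) (β l))

-- The ascending filling of a cycle

n⊖1+n : ∀ h → h ⊖ suc h ≡ -[1+ 0 ]
n⊖1+n zero    = refl
n⊖1+n (suc h) = trans (ℤ.[1+m]⊖[1+n]≡m⊖n h (suc h)) (n⊖1+n h)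

1+n⊖n : ∀ h → suc h ⊖ h ≡ + 1
1+n⊖n zero    = refl
1+n⊖n (suc h) = trans (ℤ.[1+m]⊖[1+n]≡m⊖n (suc h) h) (1+n⊖n h)

col-pair-sum : ∀ h → +[1+ h ] +ℤ -[1+ suc h ] ≡ -[1+ 0 ]
col-pair-sum h = trans (ℤ.[1+m]⊖[1+n]≡m⊖n h (suc h)) (n⊖1+n h)

row-pair-sum-step : ∀ X p → +[1+ X + (suc p + suc p) ] +ℤ -[1+ suc (X + (p + p)) ] ≡ + 1
row-pair-sum-step X p = begin
  suc (X + (suc p + suc p)) ⊖ suc (suc H)  ≡⟨ cong (λ z → suc z ⊖ suc (suc H)) X+[2p+2]≡H+2 ⟩
  suc (suc (suc H)) ⊖ suc (suc H)          ≡⟨ ℤ.[1+m]⊖[1+n]≡m⊖n (suc (suc H)) (suc H) ⟩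
  suc (suc H) ⊖ suc H                      ≡⟨ ℤ.[1+m]⊖[1+n]≡m⊖n (suc H) H ⟩
  suc H ⊖ H                                ≡⟨ 1+n⊖n H ⟩
  + 1                                      ∎
  where
  open ≡-Reasoning
  H = X + (p + p)
  X+[2p+2]≡H+2 : X + (suc p + suc p) ≡ suc (suc H)
  X+[2p+2]≡H+2 = trans (cong (λ z → X + suc z) (ℕ.+-suc p p)) (trans (ℕ.+-suc X _) (cong suc (ℕ.+-suc X _)))

row-pair-sum-wrap : ∀ X k → +[1+ X + 0 ] +ℤ -[1+ suc (X + (k + k)) ] ≡ -[1+ k + k ]
row-pair-sum-wrap X k = begin
  suc (X + 0) ⊖ suc (suc (X + (k + k)))  ≡⟨ ℤ.[1+m]⊖[1+n]≡m⊖n (X + 0) (suc (X + (k + k))) ⟩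
  (X + 0) ⊖ suc (X + (k + k))            ≡⟨ cong ((X + 0) ⊖_) (sym (ℕ.+-suc X (k + k))) ⟩
  (X + 0) ⊖ (X + suc (k + k))            ≡⟨ ℤ.+-cancelˡ-⊖ X 0 (suc (k + k)) ⟩
  -[1+ k + k ]                           ∎
  where open ≡-Reasoning

row-total : ℕ → Bool → ℤ
row-total k true  = -[1+ k + k ]
row-total k false = + 1

Interval : ℕ → ℕ → ℕ → Set
Interval X m y = ∃[ i ] (1 ≤ i × i ≤ m × y ≡ X + i)

even-or-odd : ∀ t → ∃[ q ] (t ≡ q + q ⊎ t ≡ suc (q + q))
even-or-odd zero    = 0 , inj₁ refl
even-or-odd (suc t) with even-or-odd t
... | q , inj₁ t≡2q   = q , inj₂ (cong suc t≡2q)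
... | q , inj₂ t≡2q+1 = suc q , inj₁ (trans (cong suc t≡2q+1) (cong suc (sym (ℕ.+-suc q q))))

halve : ∀ {k t} → t < suc k + suc k → ∃[ l ] (t ≡ toℕ {suc k} l + toℕ l ⊎ t ≡ suc (toℕ l + toℕ l))
halve {k} {t} t<2k+2 with even-or-odd t
... | q , parity = fromℕ< (s≤s q≤k) , subst (λ p → t ≡ p + p ⊎ t ≡ suc (p + p)) (sym (Fin.toℕ-fromℕ< (s≤s q≤k))) parity
  where
  q+q≤t : t ≡ q + q ⊎ t ≡ suc (q + q) → q + q ≤ t
  q+q≤t (inj₁ refl) = ℕ.≤-refl
  q+q≤t (inj₂ refl) = ℕ.n≤1+n _
  q≤k : q ≤ k
  q≤k = ℕ.≮⇒≥ (λ k<q → ℕ.<-irrefl refl (ℕ.<-≤-trans t<2k+2 (ℕ.≤-trans (ℕ.+-mono-≤ k<q k<q) (q+q≤t parity))))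

height : ∀ {k} → ℕ → Fin (suc k) → ℕ
height X l = X + (toℕ l + toℕ l)

forward-value backward-value : ∀ {k} → ℕ → Fin (suc k) → ℤ
forward-value  X l = +[1+ height X l ]
backward-value X l = -[1+ suc (height X l) ]

module _ {n k : ℕ} {C : Cells n} (D : Cycle k C) where
  open Cycle D

  ascending : ℕ → Fin n → Fin n → ℤ
  ascending X = fill D (forward-value X) (backward-value X)

  module _ (X : ℕ) where

    private
      a b : Fin (suc k) → ℤ
      a = forward-value X
      b = backward-value X

    ∣ascending-forward∣ : ∀ l → ∣ ascending X (r l) (c l) ∣ ≡ X + suc (toℕ l + toℕ l)
    ∣ascending-forward∣ l = trans (cong ∣_∣ (fill-forward D a b l)) (sym (ℕ.+-suc X _))

    ∣ascending-backward∣ : ∀ l → ∣ ascending X (r (next l)) (c l) ∣ ≡ X + suc (suc (toℕ l + toℕ l))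
    ∣ascending-backward∣ l = trans (cong ∣_∣ (fill-backward D a b l))
      (trans (cong suc (sym (ℕ.+-suc X _))) (sym (ℕ.+-suc X _)))

    ascending-entries : ∀ {i j} → C i j ≡ true → Interval X (suc k + suc k) ∣ ascending X i j ∣
    ascending-entries {i} {j} Cij with within i j Cij
    ... | l , inj₁ (refl , refl) = suc (toℕ l + toℕ l) , s≤s z≤n
          , s≤s (ℕ.+-mono-≤ (Fin.toℕ≤pred[n] l) (Fin.toℕ≤n l)) , ∣ascending-forward∣ l
    ... | l , inj₂ (refl , refl) = suc (suc (toℕ l + toℕ l)) , s≤s z≤n
          , s≤s (subst (_≤ k + suc k) (ℕ.+-suc (toℕ l) (toℕ l))
                       (ℕ.+-mono-≤ (Fin.toℕ≤pred[n] l) (s≤s (Fin.toℕ≤pred[n] l))))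
          , ∣ascending-backward∣ l

    ascending-attains : ∀ {y} → Interval X (suc k + suc k) y → ∃[ i ] ∃[ j ] (C i j ≡ true × ∣ ascending X i j ∣ ≡ y)
    ascending-attains (suc t , _ , t<2k+2 , refl) with halve t<2k+2
    ... | l , inj₁ refl = r l , c l , forward l , ∣ascending-forward∣ l
    ... | l , inj₂ refl = r (next l) , c l , backward l , ∣ascending-backward∣ l

    ascending-filling : Filling C (Interval X (suc k + suc k)) (ascending X)
    ascending-filling = record
      { vanishes      = fill-vanishes D a b
      ; entries       = ascending-entries
      ; attains       = ascending-attains
      ; rows-balanced = fill-rows-balanced D (height X) (suc ∘′ height X)
      ; cols-balanced = fill-cols-balanced D (height X) (suc ∘′ height X)
      }

    ascending-row-sum : ∀ {i} → InRows D i → sum (λ j → ascending X i j) ≡ row-total k (does (r zero ≟ i))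
    ascending-row-sum i∈ with entering D i∈
    ... | l , refl = trans (fill-row-sum D a b l refl) (row-step l)
      where
      row-step : ∀ l → forward-value X (next l) +ℤ backward-value X l ≡ row-total k (does (r zero ≟ r (next l)))
      row-step l with next-toℕ l
      ... | inj₁ l↦l+1 = begin
        forward-value X (next l) +ℤ backward-value X l
          ≡⟨ cong (λ p → +[1+ X + (p + p) ] +ℤ backward-value X l) l↦l+1 ⟩
        +[1+ X + (suc (toℕ l) + suc (toℕ l)) ] +ℤ backward-value X l
          ≡⟨ row-pair-sum-step X (toℕ l) ⟩
        row-total k false
          ≡⟨ cong (row-total k) (sym (dec-false (r zero ≟ r (next l)) not-start)) ⟩
        row-total k (does (r zero ≟ r (next l)))  ∎
        where
        open ≡-Reasoning
        not-start : r zero ≢ r (next l)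
        not-start eq = ℕ.0≢1+n (trans (cong toℕ (r-injective eq)) l↦l+1)
      ... | inj₂ (l↦0 , l≡k) = begin
        forward-value X (next l) +ℤ backward-value X l
          ≡⟨ cong₂ (λ x p → forward-value X x +ℤ -[1+ suc (X + (p + p)) ]) l↦0 l≡k ⟩
        +[1+ X + 0 ] +ℤ -[1+ suc (X + (k + k)) ]
          ≡⟨ row-pair-sum-wrap X k ⟩
        row-total k true
          ≡⟨ cong (row-total k) (sym (dec-true (r zero ≟ r (next l)) (cong r (sym l↦0)))) ⟩
        row-total k (does (r zero ≟ r (next l)))  ∎
        where open ≡-Reasoning

    ascending-col-sum : ∀ {j} → InCols D j → sum (λ i → ascending X i j) ≡ -[1+ 0 ]
    ascending-col-sum (l , cl≡j) = trans (fill-col-sum D a b l cl≡j) (col-pair-sum (height X l))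

    ascending-row-sum-off : ∀ {i} → ¬ InRows D i → sum (λ j → ascending X i j) ≡ + 0
    ascending-row-sum-off = fill-row-sum-off D a b

    ascending-col-sum-off : ∀ {j} → ¬ InCols D j → sum (λ i → ascending X i j) ≡ + 0
    ascending-col-sum-off = fill-col-sum-off D a b

-- Two-factors made of two cycles

ExactlyOne : Set → Set → Set
ExactlyOne A B = (A × ¬ B) ⊎ (¬ A × B)

exactly-one-by-count : ∀ {A B : Set} {x y : ℕ} → Dec A → Dec B →
  (A → x ≡ 2) → (¬ A → x ≡ 0) → (B → y ≡ 2) → (¬ B → y ≡ 0) → x + y ≡ 2 → ExactlyOne A B
exactly-one-by-count (yes a) (yes b) x≡2 _ y≡2 _ x+y≡2
  with () ← trans (sym (cong₂ _+_ (x≡2 a) (y≡2 b))) x+y≡2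
exactly-one-by-count (yes a) (no ¬b) _ _ _ _ _ = inj₁ (a , ¬b)
exactly-one-by-count (no ¬a) (yes b) _ _ _ _ _ = inj₂ (¬a , b)
exactly-one-by-count (no ¬a) (no ¬b) _ x≡0 _ y≡0 x+y≡2
  with () ← trans (sym (cong₂ _+_ (x≡0 ¬a) (y≡0 ¬b))) x+y≡2

record Factorization {n} (k : ℕ) (S : Cells n) : Set where
  field
    C C'       : Cells n
    cycle      : Cycle k C
    cycle'     : Cycle k C'
    disjoint   : Disjoint C C'
    union      : ∀ i j → S i j ≡ C i j ∨ C' i j
    two-factor : IsTwoFactor S

  start start' : Fin n
  start  = Cycle.r cycle zero
  start' = Cycle.r cycle' zero

  rows-partition : ∀ i → ExactlyOne (InRows cycle i) (InRows cycle' i)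
  rows-partition i = exactly-one-by-count (inRows? cycle i) (inRows? cycle' i)
    (row-count-on cycle) (row-count-off cycle) (row-count-on cycle') (row-count-off cycle')
    (trans (sym (count-∨ (λ j → C i j) (λ j → C' i j) (disjoint-∧ disjoint i)))
           (trans (count-cong (λ j → sym (union i j))) (proj₁ two-factor i)))

  cols-partition : ∀ j → ExactlyOne (InCols cycle j) (InCols cycle' j)
  cols-partition j = exactly-one-by-count (inCols? cycle j) (inCols? cycle' j)
    (col-count-on cycle) (col-count-off cycle) (col-count-on cycle') (col-count-off cycle')
    (trans (sym (count-∨ (λ i → C i j) (λ i → C' i j) (λ i → disjoint-∧ disjoint i j)))
           (trans (count-cong (λ i → sym (union i j))) (proj₂ two-factor j)))

module _ {n k : ℕ} {S : Cells n} where

  factorization : n ≡ suc k + suc k → IsTwoFactorOfTwoNCycles S → Factorization k S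
  factorization n≡ (two-factor , C , C' , is-cycle , is-cycle' , disjoint , union) = record
    { C = C ; C' = C' ; cycle = toCycle n≡ is-cycle ; cycle' = toCycle n≡ is-cycle'
    ; disjoint = disjoint ; union = union ; two-factor = two-factor }

  swap : Factorization k S → Factorization k S
  swap F = record
    { C = C' ; C' = C ; cycle = cycle' ; cycle' = cycle
    ; disjoint = λ i j (c' , c) → disjoint i j (c , c')
    ; union = λ i j → trans (union i j) (∨-comm (C i j) (C' i j)) ; two-factor = two-factor }
    where open Factorization F

  rotated : (F : Factorization k S) → let open Factorization F in
            ∀ {ρ ρ'} → InRows cycle ρ → InRows cycle' ρ' →
            Σ[ G ∈ Factorization k S ] (Factorization.start G ≡ ρ × Factorization.start' G ≡ ρ')
  rotated F (l , rl≡ρ) (l' , r'l'≡ρ') =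
    record F { cycle = rotate cycle l ; cycle' = rotate cycle' l' } ,
    trans (rotate-start cycle l) rl≡ρ , trans (rotate-start cycle' l') r'l'≡ρ'
    where open Factorization F

image-too-small : ∀ {m} {A : Set} (f : Fin m → A) (g : Fin (suc m) → A) → Injective _≡_ _≡_ g →
                  ¬ (∀ x → ∃[ l ] f l ≡ g x)
image-too-small {m} f g g-inj g⊆f = Fin.<⇒notInjective (ℕ.n<1+n m) index-injective
  where
  index-injective : Injective _≡_ _≡_ (λ x → proj₁ (g⊆f x))
  index-injective {x} {y} eq = g-inj (trans (sym (proj₂ (g⊆f x))) (trans (cong f eq) (proj₂ (g⊆f y))))

∷-injective : ∀ {m} {A : Set} {x : A} {f : Fin m → A} → (∀ l → f l ≢ x) → Injective _≡_ _≡_ f →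
              Injective _≡_ _≡_ (x ∷ f)
∷-injective x∉f f-inj {zero}  {zero}   _  = refl
∷-injective x∉f f-inj {zero}  {suc l'} eq = ⊥-elim (x∉f l' (sym eq))
∷-injective x∉f f-inj {suc l} {zero}   eq = ⊥-elim (x∉f l eq)
∷-injective x∉f f-inj {suc l} {suc l'} eq = cong suc (f-inj eq)

module _ {n k : ℕ} {S T : Cells n} (F : Factorization k S) (G : Factorization k T) where
  private
    module F = Factorization F
    module G = Factorization G
    r' = Cycle.r F.cycle'

  second-common-row : ∀ {ρ} → InRows F.cycle ρ → InRows G.cycle ρ →
                      ∃[ ρ' ] (InRows F.cycle' ρ' × InRows G.cycle' ρ')
  second-common-row {ρ} ρ∈F ρ∈G with Fin.any? (λ l → inRows? G.cycle' (r' l))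
  ... | yes (l , r'l∈G') = r' l , (l , refl) , r'l∈G'
  ... | no none-in-G' = ⊥-elim (image-too-small (Cycle.r G.cycle) (ρ ∷ r')
                                   (∷-injective ρ∉F' (Cycle.r-injective F.cycle')) in-G)
    where
    ρ∉F' : ∀ l → r' l ≢ ρ
    ρ∉F' l eq with F.rows-partition ρ
    ... | inj₁ (_ , ρ∉) = ρ∉ (l , eq)
    ... | inj₂ (ρ∉ , _) = ρ∉ ρ∈F
    in-G : ∀ x → InRows G.cycle ((ρ ∷ r') x)
    in-G zero    = ρ∈G
    in-G (suc l) with G.rows-partition (r' l)
    ... | inj₁ (in-G , _)  = in-G
    ... | inj₂ (_ , in-G') = ⊥-elim (none-in-G' (l , in-G'))

Aligned : ∀ {n k : ℕ} {S T : Cells n} → Factorization k S → Factorization k T → Set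
Aligned F G = Factorization.start F ≡ Factorization.start G × Factorization.start' F ≡ Factorization.start' G

module _ {n k : ℕ} {S T : Cells n} where
  open Factorization

  aligned-at : (F : Factorization k S) (G : Factorization k T) → InRows (cycle G) (start F) →
               Σ[ F ∈ Factorization k S ] Σ[ G ∈ Factorization k T ] Aligned F G
  aligned-at F G ρ∈G with second-common-row F G (zero , refl) ρ∈G
  ... | ρ' , ρ'∈F' , ρ'∈G' with rotated F (zero , refl) ρ'∈F' | rotated G ρ∈G ρ'∈G'
  ...   | F₀ , F₀-start , F₀-start' | G₀ , G₀-start , G₀-start' =
    F₀ , G₀ , trans F₀-start (sym G₀-start) , trans F₀-start' (sym G₀-start')

  align : Factorization k S → Factorization k T →
          Σ[ F ∈ Factorization k S ] Σ[ G ∈ Factorization k T ] Aligned F G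
  align F G with rows-partition G (start F)
  ... | inj₁ (ρ∈G , _)  = aligned-at F G ρ∈G
  ... | inj₂ (_ , ρ∈G') = aligned-at F (swap G) ρ∈G'

module _ {n k : ℕ} {S : Cells n} (F : Factorization k S) (X Y : ℕ) where
  open Factorization F

  factor-fill : Fin n → Fin n → ℤ
  factor-fill i j = ascending cycle X i j +ℤ ascending cycle' Y i j

  factor-filling : Filling S (Interval X (suc k + suc k) ∪ Interval Y (suc k + suc k)) factor-fill
  factor-filling = filling-∪ union disjoint (ascending-filling cycle X) (ascending-filling cycle' Y)

  factor-row-sum : ∀ i → sum (λ j → factor-fill i j) ≡ row-total k (does (start ≟ i) ∨ does (start' ≟ i))
  factor-row-sum i =
    trans (∑-distrib-+ (ascending cycle X i) (ascending cycle' Y i)) (by-partition (rows-partition i))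
    where
    by-partition : ExactlyOne (InRows cycle i) (InRows cycle' i) →
                   sum (ascending cycle X i) +ℤ sum (ascending cycle' Y i)
                     ≡ row-total k (does (start ≟ i) ∨ does (start' ≟ i))
    by-partition (inj₁ (i∈ , i∉')) =
      trans (cong₂ _+ℤ_ (ascending-row-sum cycle X i∈) (ascending-row-sum-off cycle' Y i∉'))
            (trans (ℤ.+-identityʳ _) (cong (row-total k)
              (sym (trans (cong (does (start ≟ i) ∨_) (dec-false (start' ≟ i) (λ eq → i∉' (zero , eq))))
                          (∨-identityʳ _)))))
    by-partition (inj₂ (i∉ , i∈')) =
      trans (cong₂ _+ℤ_ (ascending-row-sum-off cycle X i∉) (ascending-row-sum cycle' Y i∈'))
            (trans (ℤ.+-identityˡ _) (cong (row-total k)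
              (sym (cong (_∨ does (start' ≟ i)) (dec-false (start ≟ i) (λ eq → i∉ (zero , eq)))))))

  factor-col-sum : ∀ j → sum (λ i → factor-fill i j) ≡ -[1+ 0 ]
  factor-col-sum j with cols-partition j
  ... | inj₁ (j∈ , j∉') =
    trans (∑-distrib-+ (λ i → ascending cycle X i j) (λ i → ascending cycle' Y i j))
          (cong₂ _+ℤ_ (ascending-col-sum cycle X j∈) (ascending-col-sum-off cycle' Y j∉'))
  ... | inj₂ (j∉ , j∈') =
    trans (∑-distrib-+ (λ i → ascending cycle X i j) (λ i → ascending cycle' Y i j))
          (cong₂ _+ℤ_ (ascending-col-sum-off cycle X j∉) (ascending-col-sum cycle' Y j∈'))

module _ {n k : ℕ} {S₁ S₂ : Cells n} (F₁ : Factorization k S₁) (F₂ : Factorization k S₂) (s t u v : ℕ) where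

  opposed-fill : Fin n → Fin n → ℤ
  opposed-fill i j = factor-fill F₁ s t i j +ℤ - factor-fill F₂ u v i j

  opposed-filling : Disjoint S₁ S₂ →
                    Filling (λ i j → S₁ i j ∨ S₂ i j) (SuppSet (suc k + suc k) s t u v) opposed-fill
  opposed-filling S₁∩S₂=∅ = filling-⇔ to-SuppSet from-SuppSet
    (filling-∪ (λ _ _ → refl) S₁∩S₂=∅ (factor-filling F₁ s t) (filling-neg (factor-filling F₂ u v)))
    where
    Intervals : ℕ → ℕ → Set
    Intervals m = (Interval s m ∪ Interval t m) ∪ (Interval u m ∪ Interval v m)
    to-SuppSet : ∀ {m y} → Intervals m y → SuppSet m s t u v y
    to-SuppSet (inj₁ (inj₁ (i , 1≤i , i≤m , eq))) = i , 1≤i , i≤m , inj₁ eq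
    to-SuppSet (inj₁ (inj₂ (i , 1≤i , i≤m , eq))) = i , 1≤i , i≤m , inj₂ (inj₁ eq)
    to-SuppSet (inj₂ (inj₁ (i , 1≤i , i≤m , eq))) = i , 1≤i , i≤m , inj₂ (inj₂ (inj₁ eq))
    to-SuppSet (inj₂ (inj₂ (i , 1≤i , i≤m , eq))) = i , 1≤i , i≤m , inj₂ (inj₂ (inj₂ eq))
    from-SuppSet : ∀ {m y} → SuppSet m s t u v y → Intervals m y
    from-SuppSet (i , 1≤i , i≤m , inj₁ eq)               = inj₁ (inj₁ (i , 1≤i , i≤m , eq))
    from-SuppSet (i , 1≤i , i≤m , inj₂ (inj₁ eq))        = inj₁ (inj₂ (i , 1≤i , i≤m , eq))
    from-SuppSet (i , 1≤i , i≤m , inj₂ (inj₂ (inj₁ eq))) = inj₂ (inj₁ (i , 1≤i , i≤m , eq))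
    from-SuppSet (i , 1≤i , i≤m , inj₂ (inj₂ (inj₂ eq))) = inj₂ (inj₂ (i , 1≤i , i≤m , eq))

  opposed-row-sum : Aligned F₁ F₂ → ∀ i → sum (λ j → opposed-fill i j) ≡ + 0
  opposed-row-sum (same-start , same-start') i = begin
    sum (λ j → opposed-fill i j)
      ≡⟨ ∑-distrib-+ (factor-fill F₁ s t i) (λ j → - factor-fill F₂ u v i j) ⟩
    sum (factor-fill F₁ s t i) +ℤ sum (λ j → - factor-fill F₂ u v i j)
      ≡⟨ cong (sum (factor-fill F₁ s t i) +ℤ_) (sum-neg (factor-fill F₂ u v i)) ⟩
    sum (factor-fill F₁ s t i) +ℤ - sum (factor-fill F₂ u v i)
      ≡⟨ cong₂ (λ a b → a +ℤ - b) (factor-row-sum F₁ s t i) (factor-row-sum F₂ u v i) ⟩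
    weight F₁ +ℤ - weight F₂
      ≡⟨ cong (λ w → weight F₁ +ℤ - w) (sym same-weight) ⟩
    weight F₁ +ℤ - weight F₁
      ≡⟨ ℤ.+-inverseʳ (weight F₁) ⟩
    + 0  ∎
    where
    open ≡-Reasoning
    weight : ∀ {S} → Factorization k S → ℤ
    weight F = row-total k (does (Factorization.start F ≟ i) ∨ does (Factorization.start' F ≟ i))
    same-weight : weight F₁ ≡ weight F₂
    same-weight = cong₂ (λ ρ ρ' → row-total k (does (ρ ≟ i) ∨ does (ρ' ≟ i))) same-start same-start'

  opposed-col-sum : ∀ j → sum (λ i → opposed-fill i j) ≡ + 0
  opposed-col-sum j = begin
    sum (λ i → opposed-fill i j)
      ≡⟨ ∑-distrib-+ (λ i → factor-fill F₁ s t i j) (λ i → - factor-fill F₂ u v i j) ⟩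
    sum (λ i → factor-fill F₁ s t i j) +ℤ sum (λ i → - factor-fill F₂ u v i j)
      ≡⟨ cong (sum (λ i → factor-fill F₁ s t i j) +ℤ_) (sum-neg (λ i → factor-fill F₂ u v i j)) ⟩
    sum (λ i → factor-fill F₁ s t i j) +ℤ - sum (λ i → factor-fill F₂ u v i j)
      ≡⟨ cong₂ (λ a b → a +ℤ - b) (factor-col-sum F₁ s t j) (factor-col-sum F₂ u v j) ⟩
    + 0  ∎
    where open ≡-Reasoning

half-length : ∀ {n} {S : Cells n} → IsTwoFactorOfTwoNCycles S → ∃[ k ] n ≡ suc k + suc k
half-length (_ , _ , _ , (k , _ , n≡ , _) , _) = k , n≡

lemma2p4 : (n : ℕ) → 2 ∣ n → (S₁ S₂ : Cells n) →
    IsTwoFactorOfTwoNCycles S₁ → IsTwoFactorOfTwoNCycles S₂ → Disjoint S₁ S₂ →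
    (s t u v : ℕ) → 0 < s → 0 < t → 0 < u → 0 < v →
    t + n < s → u + n < t → v + n < u →
    Σ (PFA n) λ A →
    (∀ i j → filled (A i j) ≡ (S₁ i j ∨ S₂ i j)) ×
    Shiftable A ×
    HasSupport A (SuppSet n s t u v) ×
    (∀ i → sumLine (λ j → A i j) ≡ + 0) ×
    (∀ j → sumLine (λ i → A i j) ≡ + 0)
lemma2p4 n _ S₁ S₂ is-factor₁ is-factor₂ S₁∩S₂=∅ s t u v _ _ _ _ _ _ _
  with k , n≡ ← half-length is-factor₁
  with F₁ , F₂ , aligned ← align (factorization n≡ is-factor₁) (factorization n≡ is-factor₂) =
    toPFA S E
  , toPFA-filled filling
  , toPFA-shiftable filling
  , subst (λ m → HasSupport (toPFA S E) (SuppSet m s t u v)) (sym n≡) (toPFA-support filling)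
  , (λ i → trans (toPFA-row-sum filling i) (opposed-row-sum F₁ F₂ s t u v aligned i))
  , (λ j → trans (toPFA-col-sum filling j) (opposed-col-sum F₁ F₂ s t u v j))
  where
  S : Cells n
  S i j = S₁ i j ∨ S₂ i j
  E : Fin n → Fin n → ℤ
  E = opposed-fill F₁ F₂ s t u v
  filling : Filling S (SuppSet (suc k + suc k) s t u v) E
  filling = opposed-filling F₁ F₂ s t u v S₁∩S₂=∅
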